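{- Let $s\ge k\ge1$ be integers and $G$ an $(s,k)$-unbreakable graph with $|V(G)|\ge(2s)^{k+2}$. Then every tree decomposition of $G$ all of whose adhesions have size $<k$ has exactly one bag of size $\ge 2s$.
   Context: Graphs are finite, simple, undirected. A vertex cut of $G$ is a pair $(A,B)$ with $A\cup B=V(G)$ and no edge between $A\setminus B$ and $B\setminus A$; its order is $|A\cap B|$. $G$ is $(s,k)$-unbreakable if there is no vertex cut $(A,B)$ of order $<k$ with $|A|\ge s$ and $|B|\ge s$. A tree decomposition $(T,\mathsf{bag})$ requires every edge inside some bag and, for each vertex, the nodes whose bags contain it to induce a non-empty connected subtree; the adhesion of $st\in E(T)$ is $\mathsf{bag}(s)\cap\mathsf{bag}(t)$ (a decomposition with a single node has no adhesions). -}

module Defs where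

open import Data.Nat using (ℕ; _≤_; _<_; suc; _*_; _^_; _+_)
open import Data.Fin using (Fin)
open import Data.Fin.Subset using (Subset; _∈_; _∉_; _∩_; _∪_; ⊤; ∣_∣)
open import Data.List using (List; []; _∷_; _∷ʳ_; length)
open import Data.List.Relation.Unary.Linked using (Linked)
open import Data.List.Relation.Unary.Unique.Propositional using (Unique)
open import Data.Product using (Σ; ∃; _×_; _,_)
open import Relation.Binary.PropositionalEquality using (_≡_)
open import Relation.Nullary using (¬_)
open import Level using (0ℓ) renaming (suc to lsuc)

record Graph (n : ℕ) : Set₁ where
  field
    Adj   : Fin n → Fin n → Set
    sym   : ∀ {u v} → Adj u v → Adj v u
    irrefl : ∀ {u} → ¬ Adj u u
open Graph public

data WalkIn {n : ℕ} (G : Graph n) (P : Fin n → Set) : Fin n → Fin n → Set where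
  here : ∀ {x} → P x → WalkIn G P x x
  step : ∀ {x y z} → P x → Adj G x y → WalkIn G P y z → WalkIn G P x z

InducesConnected : {n : ℕ} → Graph n → (Fin n → Set) → Set
InducesConnected G P = ∀ x y → P x → P y → WalkIn G P x y

AllVertices : {n : ℕ} → Fin n → Set
AllVertices _ = Data.Unit.⊤ where import Data.Unit

HasCycle : {n : ℕ} → Graph n → Set
HasCycle {n} G =
  Σ (Fin n) λ x → Σ (List (Fin n)) λ ys → Σ (Fin n) λ y →
    (1 ≤ length ys) × Unique (x ∷ (ys ∷ʳ y)) × Linked (Adj G) (x ∷ (ys ∷ʳ y)) × Adj G y x

record IsTree {m : ℕ} (T : Graph m) : Set where
  field
    nonempty  : Fin m
    connected : InducesConnected T AllVertices
    acyclic   : ¬ HasCycle T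

IsVertexCut : {n : ℕ} → Graph n → Subset n → Subset n → Set
IsVertexCut G A B =
  (A ∪ B ≡ ⊤) ×
  (∀ u v → u ∈ A → u ∉ B → v ∈ B → v ∉ A → ¬ Adj G u v)

order : {n : ℕ} → Subset n → Subset n → ℕ
order A B = ∣ A ∩ B ∣

Unbreakable : {n : ℕ} → ℕ → ℕ → Graph n → Set
Unbreakable s k G =
  ∀ A B → IsVertexCut G A B → order A B < k → s ≤ ∣ A ∣ → s ≤ ∣ B ∣ → Data.Empty.⊥
  where import Data.Empty

record TreeDecomposition {n : ℕ} (G : Graph n) : Set₁ where
  field
    m      : ℕ
    T      : Graph m
    isTree : IsTree T
    bag    : Fin m → Subset n
    edgeCovered : ∀ u v → Adj G u v → ∃ λ t → u ∈ bag t × v ∈ bag t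
    vertexNonempty : ∀ v → ∃ λ t → v ∈ bag t
    vertexConnected : ∀ v → InducesConnected T (λ t → v ∈ bag t)
open TreeDecomposition public

adhesion : {n : ℕ} {G : Graph n} (D : TreeDecomposition G) → Fin (m D) → Fin (m D) → Subset n
adhesion D s t = bag D s ∩ bag D t

AdhesionsBelow : {n : ℕ} {G : Graph n} → TreeDecomposition G → ℕ → Set
AdhesionsBelow D k = ∀ s t → Adj (T D) s t → ∣ adhesion D s t ∣ < k

ExactlyOneBagOfSizeAtLeast : {n : ℕ} {G : Graph n} → TreeDecomposition G → ℕ → Set
ExactlyOneBagOfSizeAtLeast D b =
  ∃ λ t → (b ≤ ∣ bag D t ∣) × (∀ t' → b ≤ ∣ bag D t' ∣ → t' ≡ t)

module Submission where

-- Call a branch of T at t (a component of T − t) heavy if its bags cover at least s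
-- vertices. The two sides of an edge of T are separated in G by its adhesion, so they are
-- never both heavy; following heavy branches therefore ends at a balanced node t, all of
-- whose branches are light. If |bag t| < 2s, these branches still cover ≥ (2s)^k vertices.
-- Growing a set R ⊆ bag t one vertex at a time, by pigeonhole some branches whose adhesions
-- all equal R cover ≥ s vertices; a subfamily covering between s and 2s of them is cut off
-- by R from ≥ n − 2s ≥ s others, against unbreakability. Two bags of size ≥ 2s are likewise
-- separated by an adhesion on the path between them.

open import Defs
open import Data.Nat as ℕ using (ℕ; zero; suc; pred; _≤_; _<_; _*_; _^_; _+_; z≤n; s≤s; NonZero)
open import Data.Nat.Properties hiding (_≟_)
open import Data.Nat.Induction using (<-rec)
open import Data.Fin using (Fin; zero; suc; _≟_)
open import Data.Fin.Properties using (any?; all?; ¬∀⟶∃¬)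
open import Data.Fin.Subset using (Subset; _∈_; _∉_; _∩_; _∪_; ⊤; ⊥; ∣_∣; _⊆_; _⊂_; ∁; ⁅_⁆; inside; outside)
open import Data.Fin.Subset.Properties
open import Data.Vec.Base using ([]; _∷_; here; there)
open import Data.List using (List; []; _∷_; _∷ʳ_)
open import Data.List.Membership.Propositional using () renaming (_∈_ to _∈ₗ_)
open import Data.List.Relation.Unary.All as All using (All; []; _∷_)
open import Data.List.Relation.Unary.Any using (here; there)
open import Data.List.Relation.Unary.AllPairs using ([]; _∷_)
open import Data.List.Relation.Unary.Linked using (Linked; [-]; _∷_)
open import Data.List.Relation.Unary.Unique.Propositional using (Unique)
open import Data.Product using (Σ; ∃; ∃₂; _×_; _,_; proj₁; proj₂)
open import Data.Sum using (_⊎_; inj₁; inj₂)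
open import Data.Empty using (⊥-elim) renaming (⊥ to Empty)
open import Function using (_∘_)
open import Relation.Binary.PropositionalEquality as ≡ using (_≡_; _≢_; refl; cong; subst)
open import Relation.Nullary using (¬_; Dec; yes; no)
open import Relation.Nullary.Decidable using (_→-dec_; ¬?; decidable-stable; ¬¬-excluded-middle)

m^k+m≤m^[k+2] : ∀ m k → 2 ≤ m → m ^ k + m ≤ m ^ (k + 2)
m^k+m≤m^[k+2] m k 2≤m = begin
  m ^ k + m              ≤⟨ +-mono-≤ (m≤m*n (m ^ k) m) (m≤n*m m (m ^ k)) ⟩
  m ^ k * m + m ^ k * m  ≡⟨ *-distribˡ-+ (m ^ k) m m ⟨
  m ^ k * (m + m)        ≤⟨ *-monoʳ-≤ (m ^ k) m+m≤m*m ⟩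
  m ^ k * (m * m)        ≡⟨ cong (λ x → m ^ k * (m * x)) (*-identityʳ m) ⟨
  m ^ k * m ^ 2          ≡⟨ ^-distribˡ-+-* m k 2 ⟨
  m ^ (k + 2)            ∎
  where
  open ≤-Reasoning
  instance
    m≢0 : NonZero m
    m≢0 = ℕ.>-nonZero (≤-trans (s≤s z≤n) 2≤m)
    m^k≢0 : NonZero (m ^ k)
    m^k≢0 = m^n≢0 m k
  m+m≤m*m : m + m ≤ m * m
  m+m≤m*m = begin
    m + m        ≡⟨ cong (m +_) (+-identityʳ m) ⟨
    2 * m        ≤⟨ *-monoˡ-≤ m 2≤m ⟩
    m * m        ∎

m+n≤o+p∧o<n⇒m<p : ∀ {m n o p} → m + n ≤ o + p → o < n → m < p
m+n≤o+p∧o<n⇒m<p {m} {n} {o} {p} le o<n = +-cancelʳ-< n m p (begin-strict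
  m + n  ≤⟨ le ⟩
  o + p  <⟨ +-monoˡ-< p o<n ⟩
  n + p  ≡⟨ +-comm n p ⟩
  p + n  ∎)
  where open ≤-Reasoning

a<p∧b<q⇒a+b*p<q*p : ∀ {a b p q} → a < p → b < q → a + b * p < q * p
a<p∧b<q⇒a+b*p<q*p {a} {b} {p} {q} a<p b<q = begin-strict
  a + b * p  <⟨ +-monoˡ-< (b * p) a<p ⟩
  suc b * p  ≤⟨ *-monoˡ-≤ p b<q ⟩
  q * p      ∎
  where open ≤-Reasoning

∣p∪q∣≤∣p∣+∣q∣ : ∀ {n} (p q : Subset n) → ∣ p ∪ q ∣ ≤ ∣ p ∣ + ∣ q ∣
∣p∪q∣≤∣p∣+∣q∣ []            []            = z≤n
∣p∪q∣≤∣p∣+∣q∣ (inside  ∷ p) (inside  ∷ q) = s≤s (≤-trans (∣p∪q∣≤∣p∣+∣q∣ p q) (+-monoʳ-≤ ∣ p ∣ (n≤1+n ∣ q ∣)))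
∣p∪q∣≤∣p∣+∣q∣ (inside  ∷ p) (outside ∷ q) = s≤s (∣p∪q∣≤∣p∣+∣q∣ p q)
∣p∪q∣≤∣p∣+∣q∣ (outside ∷ p) (inside  ∷ q) =
  ≤-trans (s≤s (∣p∪q∣≤∣p∣+∣q∣ p q)) (≤-reflexive (≡.sym (+-suc ∣ p ∣ ∣ q ∣)))
∣p∪q∣≤∣p∣+∣q∣ (outside ∷ p) (outside ∷ q) = ∣p∪q∣≤∣p∣+∣q∣ p q

∣p∪⁅x⁆∣≡1+∣p∣ : ∀ {n} {x : Fin n} (p : Subset n) → x ∉ p → ∣ p ∪ ⁅ x ⁆ ∣ ≡ suc ∣ p ∣
∣p∪⁅x⁆∣≡1+∣p∣ {x = x} p x∉p = ≤-antisym
  (begin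
    ∣ p ∪ ⁅ x ⁆ ∣      ≤⟨ ∣p∪q∣≤∣p∣+∣q∣ p ⁅ x ⁆ ⟩
    ∣ p ∣ + ∣ ⁅ x ⁆ ∣  ≡⟨ cong (∣ p ∣ +_) (∣⁅x⁆∣≡1 x) ⟩
    ∣ p ∣ + 1          ≡⟨ +-comm ∣ p ∣ 1 ⟩
    suc ∣ p ∣          ∎)
  (p⊂q⇒∣p∣<∣q∣ (p⊆p∪q ⁅ x ⁆ , x , q⊆p∪q p ⁅ x ⁆ (x∈⁅x⁆ x) , x∉p))
  where open ≤-Reasoning

p⊆q∧∣q∣≤∣p∣⇒q⊆p : ∀ {n} {p q : Subset n} → p ⊆ q → ∣ q ∣ ≤ ∣ p ∣ → q ⊆ p
p⊆q∧∣q∣≤∣p∣⇒q⊆p {p = p} p⊆q ∣q∣≤∣p∣ {x} x∈q with x ∈? p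
... | yes x∈p = x∈p
... | no  x∉p = ⊥-elim (<⇒≱ (p⊂q⇒∣p∣<∣q∣ (p⊆q , x , x∈q , x∉p)) ∣q∣≤∣p∣)

p⊈q⇒∃∈p∖q : ∀ {n} {p q : Subset n} → ¬ p ⊆ q → ∃ λ x → x ∈ p × x ∉ q
p⊈q⇒∃∈p∖q {n} {p} {q} p⊈q
  with ¬∀⟶∃¬ n (λ x → x ∈ p → x ∈ q) (λ x → x ∈? p →-dec x ∈? q) (λ h → p⊈q (h _))
... | x , x∈p⇏x∈q with x ∈? p
...   | yes x∈p = x , x∈p , λ x∈q → x∈p⇏x∈q (λ _ → x∈q)
...   | no  x∉p = ⊥-elim (x∈p⇏x∈q (⊥-elim ∘ x∉p))

toSubset : ∀ {n} {P : Fin n → Set} → (∀ x → Dec (P x)) → Subset n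
toSubset {zero}  P? = []
toSubset {suc n} P? with P? zero
... | yes _ = inside  ∷ toSubset (P? ∘ suc)
... | no  _ = outside ∷ toSubset (P? ∘ suc)

∈-toSubset⁺ : ∀ {n} {P : Fin n → Set} (P? : ∀ x → Dec (P x)) {x} → P x → x ∈ toSubset P?
∈-toSubset⁺ P? {zero} p with P? zero
... | yes _  = here
... | no  ¬p = ⊥-elim (¬p p)
∈-toSubset⁺ P? {suc x} p with P? zero
... | yes _ = there (∈-toSubset⁺ (P? ∘ suc) p)
... | no  _ = there (∈-toSubset⁺ (P? ∘ suc) p)

∈-toSubset⁻ : ∀ {n} {P : Fin n → Set} (P? : ∀ x → Dec (P x)) {x} → x ∈ toSubset P? → P x
∈-toSubset⁻ P? {zero} x∈ with P? zero
∈-toSubset⁻ P? {zero} here | yes p = p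
∈-toSubset⁻ P? {suc x} x∈ with P? zero
∈-toSubset⁻ P? {suc x} (there x∈) | yes _ = ∈-toSubset⁻ (P? ∘ suc) x∈
∈-toSubset⁻ P? {suc x} (there x∈) | no  _ = ∈-toSubset⁻ (P? ∘ suc) x∈

infix 9 ⋃[_]_

⋃[_]_ : ∀ {m n} → Subset m → (Fin m → Subset n) → Subset n
⋃[ []          ] Y = ⊥
⋃[ inside  ∷ Q ] Y = Y zero ∪ ⋃[ Q ] (Y ∘ suc)
⋃[ outside ∷ Q ] Y = ⋃[ Q ] (Y ∘ suc)

∈-⋃⁺ : ∀ {m n} (Q : Subset m) (Y : Fin m → Subset n) {i x} → i ∈ Q → x ∈ Y i → x ∈ ⋃[ Q ] Y
∈-⋃⁺ (inside  ∷ Q) Y here       x∈ = p⊆p∪q (⋃[ Q ] (Y ∘ suc)) x∈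
∈-⋃⁺ (inside  ∷ Q) Y (there i∈) x∈ = q⊆p∪q (Y zero) _ (∈-⋃⁺ Q (Y ∘ suc) i∈ x∈)
∈-⋃⁺ (outside ∷ Q) Y (there i∈) x∈ = ∈-⋃⁺ Q (Y ∘ suc) i∈ x∈

∈-⋃⁻ : ∀ {m n} (Q : Subset m) (Y : Fin m → Subset n) {x} → x ∈ ⋃[ Q ] Y → ∃ λ i → i ∈ Q × x ∈ Y i
∈-⋃⁻ []            Y x∈ = ⊥-elim (∉⊥ x∈)
∈-⋃⁻ (inside  ∷ Q) Y x∈ with x∈p∪q⁻ (Y zero) _ x∈
... | inj₁ x∈Y₀ = zero , here , x∈Y₀
... | inj₂ x∈⋃  with ∈-⋃⁻ Q (Y ∘ suc) x∈⋃
...   | i , i∈Q , x∈Yi = suc i , there i∈Q , x∈Yi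
∈-⋃⁻ (outside ∷ Q) Y x∈ with ∈-⋃⁻ Q (Y ∘ suc) x∈
... | i , i∈Q , x∈Yi = suc i , there i∈Q , x∈Yi

⋃-monoˡ : ∀ {m n} {Q Q' : Subset m} (Y : Fin m → Subset n) → Q ⊆ Q' → ⋃[ Q ] Y ⊆ ⋃[ Q' ] Y
⋃-monoˡ {Q = Q} {Q'} Y Q⊆Q' x∈ with ∈-⋃⁻ Q Y x∈
... | i , i∈Q , x∈Yi = ∈-⋃⁺ Q' Y (Q⊆Q' i∈Q) x∈Yi

⋃-assoc : ∀ {l m n} (Q : Subset l) (Z : Fin l → Subset m) (Y : Fin m → Subset n) →
          ⋃[ ⋃[ Q ] Z ] Y ≡ ⋃[ Q ] (λ i → ⋃[ Z i ] Y)
⋃-assoc Q Z Y = ⊆-antisym to from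
  where
  to : ⋃[ ⋃[ Q ] Z ] Y ⊆ ⋃[ Q ] (λ i → ⋃[ Z i ] Y)
  to x∈ with ∈-⋃⁻ (⋃[ Q ] Z) Y x∈
  ... | j , j∈ , x∈Yj with ∈-⋃⁻ Q Z j∈
  ...   | i , i∈Q , j∈Zi = ∈-⋃⁺ Q _ i∈Q (∈-⋃⁺ (Z i) Y j∈Zi x∈Yj)
  from : ⋃[ Q ] (λ i → ⋃[ Z i ] Y) ⊆ ⋃[ ⋃[ Q ] Z ] Y
  from x∈ with ∈-⋃⁻ Q _ x∈
  ... | i , i∈Q , x∈⋃Zi with ∈-⋃⁻ (Z i) Y x∈⋃Zi
  ...   | j , j∈Zi , x∈Yj = ∈-⋃⁺ (⋃[ Q ] Z) Y (∈-⋃⁺ Q Z i∈Q j∈Zi) x∈Yj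

∣⋃∣≤∣Q∣*b : ∀ {m n} (Q : Subset m) (Y : Fin m → Subset n) b → (∀ {i} → i ∈ Q → ∣ Y i ∣ ≤ b) →
            ∣ ⋃[ Q ] Y ∣ ≤ ∣ Q ∣ * b
∣⋃∣≤∣Q∣*b {n = n} []  Y b _ = ≤-reflexive (∣⊥∣≡0 n)
∣⋃∣≤∣Q∣*b (inside ∷ Q) Y b ∣Y∣≤b = begin
  ∣ Y zero ∪ ⋃[ Q ] (Y ∘ suc) ∣      ≤⟨ ∣p∪q∣≤∣p∣+∣q∣ (Y zero) _ ⟩
  ∣ Y zero ∣ + ∣ ⋃[ Q ] (Y ∘ suc) ∣
    ≤⟨ +-mono-≤ (∣Y∣≤b here) (∣⋃∣≤∣Q∣*b Q (Y ∘ suc) b (∣Y∣≤b ∘ there)) ⟩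
  b + ∣ Q ∣ * b                      ∎
  where open ≤-Reasoning
∣⋃∣≤∣Q∣*b (outside ∷ Q) Y b ∣Y∣≤b = ∣⋃∣≤∣Q∣*b Q (Y ∘ suc) b (∣Y∣≤b ∘ there)

-- Take the shortest suffix of Q whose union has size ≥ s: without its first member
-- the union has size < s, and that member adds fewer than s elements.
⋃-subfamily-between : ∀ {m n} s (Q : Subset m) (Y : Fin m → Subset n) →
  1 ≤ s → (∀ {i} → i ∈ Q → ∣ Y i ∣ < s) → s ≤ ∣ ⋃[ Q ] Y ∣ →
  ∃ λ Q' → Q' ⊆ Q × s ≤ ∣ ⋃[ Q' ] Y ∣ × ∣ ⋃[ Q' ] Y ∣ < s + s
⋃-subfamily-between {n = n} s [] Y 1≤s _ s≤∣⋃∣ = ⊥-elim (<⇒≱ 1≤s (≤-trans s≤∣⋃∣ (≤-reflexive (∣⊥∣≡0 n))))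
⋃-subfamily-between s (outside ∷ Q) Y 1≤s ∣Y∣<s s≤∣⋃∣
  with ⋃-subfamily-between s Q (Y ∘ suc) 1≤s (∣Y∣<s ∘ there) s≤∣⋃∣
... | Q' , Q'⊆Q , bounds = outside ∷ Q' , out⊆ Q'⊆Q , bounds
⋃-subfamily-between s (inside ∷ Q) Y 1≤s ∣Y∣<s s≤∣⋃∣ with s ℕ.≤? ∣ ⋃[ Q ] (Y ∘ suc) ∣
... | yes s≤∣⋃Q∣ with ⋃-subfamily-between s Q (Y ∘ suc) 1≤s (∣Y∣<s ∘ there) s≤∣⋃Q∣
...   | Q' , Q'⊆Q , bounds = outside ∷ Q' , out⊆ Q'⊆Q , bounds
⋃-subfamily-between s (inside ∷ Q) Y 1≤s ∣Y∣<s s≤∣⋃∣ | no s≰∣⋃Q∣ =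
  inside ∷ Q , ⊆-refl , s≤∣⋃∣ ,
  ≤-<-trans (∣p∪q∣≤∣p∣+∣q∣ (Y zero) _) (+-mono-< (∣Y∣<s here) (≰⇒> s≰∣⋃Q∣))

adj⇒≢ : ∀ {n} (G : Graph n) {x y} → Adj G x y → y ≢ x
adj⇒≢ G {x} x~y refl = Graph.irrefl G x~y

module Walk {n} (G : Graph n) where

  open import Data.List.Membership.DecPropositional (_≟_ {n}) using () renaming (_∈?_ to _∈ₗ?_)

  start : ∀ {P x y} → WalkIn G P x y → P x
  start (here px)     = px
  start (step px _ _) = px

  end : ∀ {P x y} → WalkIn G P x y → P y
  end (here py)    = py
  end (step _ _ w) = end w

  weaken : ∀ {P Q : Fin n → Set} {x y} → (∀ {z} → P z → Q z) → WalkIn G P x y → WalkIn G Q x y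
  weaken P⇒Q (here px)     = here (P⇒Q px)
  weaken P⇒Q (step px e w) = step (P⇒Q px) e (weaken P⇒Q w)

  _++_ : ∀ {P x y z} → WalkIn G P x y → WalkIn G P y z → WalkIn G P x z
  here _     ++ w' = w'
  step p e w ++ w' = step p e (w ++ w')

  _∷ʳ⟨_⟩_ : ∀ {P x y z} → WalkIn G P x y → Adj G y z → P z → WalkIn G P x z
  w ∷ʳ⟨ e ⟩ pz = w ++ step (end w) e (here pz)

  reverse : ∀ {P x y} → WalkIn G P x y → WalkIn G P y x
  reverse (here px)     = here px
  reverse (step px e w) = reverse w ∷ʳ⟨ Graph.sym G e ⟩ px

  exit : ∀ {P x y} (X : Fin n → Set) → (∀ z → Dec (X z)) → WalkIn G P x y → X x → ¬ X y →
         ∃₂ λ p q → P p × P q × X p × ¬ X q × Adj G p q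
  exit X X? (here _) Xx ¬Xy = ⊥-elim (¬Xy Xx)
  exit X X? (step {y = z} px e w) Xx ¬Xy with X? z
  ... | yes Xz = exit X X? w Xz ¬Xy
  ... | no ¬Xz = _ , _ , px , start w , Xx , ¬Xz , e

  untilFirst : ∀ {P x} t → WalkIn G P x t → x ≢ t → ∃ λ y → Adj G y t × WalkIn G (λ z → P z × z ≢ t) x y
  untilFirst t (here _) x≢t = ⊥-elim (x≢t refl)
  untilFirst t (step {y = z} px e w) x≢t with z ≟ t
  ... | yes refl = _ , e , here (px , x≢t)
  ... | no z≢t with untilFirst t w z≢t
  ...   | y , e' , w' = y , e' , step (px , x≢t) e w'

  avoidingOrReaching : ∀ {P x y} t → WalkIn G P x y → WalkIn G (λ z → P z × z ≢ t) x y ⊎ WalkIn G P x t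
  avoidingOrReaching t (here {x} px) with x ≟ t
  ... | yes refl = inj₂ (here px)
  ... | no x≢t   = inj₁ (here (px , x≢t))
  avoidingOrReaching t (step {x} px e w) with x ≟ t
  ... | yes refl = inj₂ (here px)
  ... | no x≢t with avoidingOrReaching t w
  ...   | inj₁ w' = inj₁ (step (px , x≢t) e w')
  ...   | inj₂ w' = inj₂ (step px e w')

  vertices : ∀ {P x y} → WalkIn G P x y → List (Fin n)
  vertices (here {x} _)     = x ∷ []
  vertices (step {x} _ _ w) = x ∷ vertices w

  linked : ∀ {P x y} (w : WalkIn G P x y) → Linked (Adj G) (vertices w)
  linked (here _)                  = [-]
  linked (step _ e (here _))       = e ∷ [-]
  linked (step _ e w@(step _ _ _)) = e ∷ linked w

  all : ∀ {P x y} (w : WalkIn G P x y) → All P (vertices w)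
  all (here px)     = px ∷ []
  all (step px _ w) = px ∷ all w

  vertices-∷ʳ : ∀ {P x y} (w : WalkIn G P x y) → ∃ λ zs → vertices w ≡ zs ∷ʳ y
  vertices-∷ʳ (here _) = [] , refl
  vertices-∷ʳ (step {x} _ _ w) with vertices-∷ʳ w
  ... | zs , eq = x ∷ zs , cong (x ∷_) eq

  Path : ∀ P x y → Set
  Path P x y = Σ (WalkIn G P x y) (Unique ∘ vertices)

  suffix : ∀ {P x y z} (w : WalkIn G P y z) → Unique (vertices w) → x ∈ₗ vertices w → Path P x z
  suffix w@(here _)     u       (here refl) = w , u
  suffix w@(step _ _ _) u       (here refl) = w , u
  suffix (step _ _ w)   (_ ∷ u) (there i)   = suffix w u i

  toPath : ∀ {P x y} → WalkIn G P x y → Path P x y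
  toPath (here px) = here px , [] ∷ []
  toPath (step {x} px e w) with toPath w
  ... | w' , u with x ∈ₗ? vertices w'
  ...   | yes x∈ = suffix w' u x∈
  ...   | no  x∉ = step px e w' , All.tabulate (λ { z∈ refl → x∉ z∈ }) ∷ u

-- Otherwise a path from c to c' avoiding t closes a cycle through t.
neighbours-joined-avoiding⇒≡ : ∀ {m} (T : Graph m) → ¬ HasCycle T → ∀ {t c c'} →
  Adj T t c → Adj T t c' → WalkIn T (_≢ t) c c' → c ≡ c'
neighbours-joined-avoiding⇒≡ T acyclic {t} {c} {c'} t~c t~c' w with Walk.toPath T w
... | here _ , _ = refl
... | p@(step _ _ p') , unique with Walk.vertices-∷ʳ T p'
...   | zs , eq = ⊥-elim (acyclic (t , c ∷ zs , c' , s≤s z≤n ,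
          subst (λ vs → Unique (t ∷ c ∷ vs)) eq (All.map (λ z≢t t≡z → z≢t (≡.sym t≡z)) (Walk.all T p) ∷ unique) ,
          subst (λ vs → Linked (Adj T) (t ∷ c ∷ vs)) eq (t~c ∷ Walk.linked T p) ,
          Graph.sym T t~c'))

module Separation {n} {G : Graph n} (D : TreeDecomposition G) where

  ⋃bag : Subset (m D) → Subset n
  ⋃bag X = ⋃[ X ] bag D

  ⋃bag-∪-⋃bag-∁ : ∀ X → ⋃bag X ∪ ⋃bag (∁ X) ≡ ⊤
  ⋃bag-∪-⋃bag-∁ X = ⊆-antisym ⊆⊤ ⊤⊆
    where
    ⊤⊆ : ⊤ ⊆ ⋃bag X ∪ ⋃bag (∁ X)
    ⊤⊆ {v} _ with vertexNonempty D v
    ... | t , v∈t with t ∈? X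
    ... | yes t∈X = p⊆p∪q (⋃bag (∁ X)) (∈-⋃⁺ X (bag D) t∈X v∈t)
    ... | no  t∉X = q⊆p∪q (⋃bag X) _ (∈-⋃⁺ (∁ X) (bag D) (x∉p⇒x∈∁p t∉X) v∈t)

  n≤∣⋃bag∣+∣⋃bag-∁∣ : ∀ X → n ≤ ∣ ⋃bag X ∣ + ∣ ⋃bag (∁ X) ∣
  n≤∣⋃bag∣+∣⋃bag-∁∣ X = begin
    n                                ≡⟨ ∣⊤∣≡n n ⟨
    ∣ ⊤ {n} ∣                        ≡⟨ cong ∣_∣ (⋃bag-∪-⋃bag-∁ X) ⟨
    ∣ ⋃bag X ∪ ⋃bag (∁ X) ∣          ≤⟨ ∣p∪q∣≤∣p∣+∣q∣ (⋃bag X) _ ⟩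
    ∣ ⋃bag X ∣ + ∣ ⋃bag (∁ X) ∣      ∎
    where open ≤-Reasoning

  isVertexCut : ∀ X → IsVertexCut G (⋃bag X) (⋃bag (∁ X))
  isVertexCut X = ⋃bag-∪-⋃bag-∁ X , noEdge
    where
    noEdge : ∀ u v → u ∈ ⋃bag X → u ∉ ⋃bag (∁ X) → v ∈ ⋃bag (∁ X) → v ∉ ⋃bag X → ¬ Adj G u v
    noEdge u v _ u∉ _ v∉ u~v with edgeCovered D u v u~v
    ... | t , u∈t , v∈t with t ∈? X
    ... | yes t∈X = v∉ (∈-⋃⁺ X (bag D) t∈X v∈t)
    ... | no  t∉X = u∉ (∈-⋃⁺ (∁ X) (bag D) (x∉p⇒x∈∁p t∉X) u∈t)

  AdhesionsLeaving_⊆_ : Subset (m D) → Subset n → Set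
  AdhesionsLeaving X ⊆ R = ∀ {p q} → p ∈ X → q ∉ X → Adj (T D) p q → adhesion D p q ⊆ R

  -- The nodes whose bags contain v form a connected subtree, so they leave X along an edge.
  ⋃bag∩⋃bag-∁⊆ : ∀ {X R} → AdhesionsLeaving X ⊆ R → ⋃bag X ∩ ⋃bag (∁ X) ⊆ R
  ⋃bag∩⋃bag-∁⊆ {X} leaving {v} v∈ with x∈p∩q⁻ (⋃bag X) _ v∈
  ... | v∈X , v∈∁X with ∈-⋃⁻ X (bag D) v∈X | ∈-⋃⁻ (∁ X) (bag D) v∈∁X
  ... | p , p∈X , v∈p | q , q∈∁X , v∈q
    with Walk.exit (T D) (_∈ X) (_∈? X) (vertexConnected D v p q v∈p v∈q) p∈X (x∈∁p⇒x∉p q∈∁X)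
  ... | p' , q' , v∈p' , v∈q' , p'∈X , q'∉X , p'~q' = leaving p'∈X q'∉X p'~q' (x∈p∩q⁺ (v∈p' , v∈q'))

  no-balanced-separation : ∀ {s k} → Unbreakable s k G → ∀ X {R} → AdhesionsLeaving X ⊆ R → ∣ R ∣ < k →
    s ≤ ∣ ⋃bag X ∣ → s ≤ ∣ ⋃bag (∁ X) ∣ → Empty
  no-balanced-separation unbreakable X leaving ∣R∣<k =
    unbreakable (⋃bag X) (⋃bag (∁ X)) (isVertexCut X) (≤-<-trans (p⊆q⇒∣p∣≤∣q∣ (⋃bag∩⋃bag-∁⊆ leaving)) ∣R∣<k)

module Branches {n} {G : Graph n} (D : TreeDecomposition G)
  (adj? : ∀ x y → Dec (Adj (T D) x y))
  (branch? : ∀ t c x → Dec (WalkIn (T D) (_≢ t) c x)) where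

  open Separation D
  open Walk (T D)

  neighbours : Fin (m D) → Subset (m D)
  neighbours t = toSubset (adj? t)

  ∈-neighbours⁻ : ∀ {t c} → c ∈ neighbours t → Adj (T D) t c
  ∈-neighbours⁻ = ∈-toSubset⁻ (adj? _)

  -- branch t c: the nodes of the component of T − t containing c.
  branch : Fin (m D) → Fin (m D) → Subset (m D)
  branch t c = toSubset (branch? t c)

  ∈-branch⁺ : ∀ {t c x} → WalkIn (T D) (_≢ t) c x → x ∈ branch t c
  ∈-branch⁺ = ∈-toSubset⁺ (branch? _ _)

  ∈-branch⁻ : ∀ {t c x} → x ∈ branch t c → WalkIn (T D) (_≢ t) c x
  ∈-branch⁻ = ∈-toSubset⁻ (branch? _ _)

  ∉-branch-root : ∀ {t c} → t ∉ branch t c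
  ∉-branch-root t∈ = end (∈-branch⁻ t∈) refl

  ∈-branch-self : ∀ {t c} → Adj (T D) t c → c ∈ branch t c
  ∈-branch-self t~c = ∈-branch⁺ (here (adj⇒≢ (T D) t~c))

  private
    joined⇒≡ : ∀ {t c c'} → Adj (T D) t c → Adj (T D) t c' → WalkIn (T D) (_≢ t) c c' → c ≡ c'
    joined⇒≡ = neighbours-joined-avoiding⇒≡ (T D) (IsTree.acyclic (isTree D))

  -- The only edge leaving branch t c is the edge ct.
  branch-leaving : ∀ {t c} → Adj (T D) t c → AdhesionsLeaving branch t c ⊆ adhesion D c t
  branch-leaving {t} {c} t~c {p} {q} p∈ q∉ p~q with q ≟ t
  ... | no  q≢t = ⊥-elim (q∉ (∈-branch⁺ (∈-branch⁻ p∈ ∷ʳ⟨ p~q ⟩ q≢t)))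
  ... | yes refl =
    subst (λ r → adhesion D p q ⊆ adhesion D r q) (≡.sym (joined⇒≡ t~c (Graph.sym (T D) p~q) (∈-branch⁻ p∈))) ⊆-refl

  branch-⊂ : ∀ {t c c'} → Adj (T D) t c → Adj (T D) c c' → c' ≢ t → branch c c' ⊂ branch t c
  branch-⊂ {t} {c} {c'} t~c c~c' c'≢t = ⊆ , c , ∈-branch-self t~c , ∉-branch-root
    where
    ⊆ : branch c c' ⊆ branch t c
    ⊆ {x} x∈ with avoidingOrReaching t (∈-branch⁻ x∈)
    ... | inj₁ c'⇝x = ∈-branch⁺ (step (adj⇒≢ (T D) t~c) c~c' (weaken proj₂ c'⇝x))
    ... | inj₂ c'⇝t = ⊥-elim (c'≢t (joined⇒≡ c~c' (Graph.sym (T D) t~c) c'⇝t))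

  branches-disjoint : ∀ {t c x} → Adj (T D) t c → x ∈ branch c t → x ∉ branch t c
  branches-disjoint {t} {c} t~c x∈ct x∈tc with untilFirst t (reverse (∈-branch⁻ x∈ct)) (end (∈-branch⁻ x∈tc))
  ... | y , y~t , x⇝y = proj₁ (end x⇝y) (≡.sym (joined⇒≡ t~c (Graph.sym (T D) y~t) (∈-branch⁻ x∈tc ++ weaken proj₂ x⇝y)))

  ∈-some-branch : ∀ {t x} → x ≢ t → ∃ λ c → c ∈ neighbours t × x ∈ branch t c
  ∈-some-branch {t} {x} x≢t with untilFirst t (IsTree.connected (isTree D) x t _ _) x≢t
  ... | c , c~t , x⇝c = c , ∈-toSubset⁺ (adj? t) (Graph.sym (T D) c~t) , ∈-branch⁺ (reverse (weaken proj₂ x⇝c))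

module Unbreakable-TreeDecomposition
  {s k n} {G : Graph n} (1≤s : 1 ≤ s) (unbreakable : Unbreakable s k G)
  (D : TreeDecomposition G) (adhesions<k : AdhesionsBelow D k)
  (adj? : ∀ x y → Dec (Adj (T D) x y))
  (branch? : ∀ t c x → Dec (WalkIn (T D) (_≢ t) c x)) where

  open Separation D
  open Branches D adj? branch?

  instance
    2s≢0 : NonZero (2 * s)
    2s≢0 = ℕ.>-nonZero (≤-trans 1≤s (m≤m+n s (s + 0)))

  s≤[2s]^[1+d] : ∀ d → s ≤ (2 * s) ^ suc d
  s≤[2s]^[1+d] d = ≤-trans (m≤m+n s (s + 0)) (m≤m*n (2 * s) ((2 * s) ^ d) {{m^n≢0 (2 * s) d}})

  Heavy : Fin (m D) → Fin (m D) → Set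
  Heavy t c = s ≤ ∣ ⋃bag (branch t c) ∣

  Balanced : Fin (m D) → Set
  Balanced t = ∀ c → Adj (T D) t c → ¬ Heavy t c

  heavy⇒complement-light : ∀ {t c} → Adj (T D) t c → Heavy t c → ∣ ⋃bag (∁ (branch t c)) ∣ < s
  heavy⇒complement-light {t} {c} t~c heavy = ≰⇒> λ heavy' →
    no-balanced-separation unbreakable (branch t c) (branch-leaving t~c) (adhesions<k c t (Graph.sym (T D) t~c)) heavy heavy'

  unbalanced⇒heavy : ∀ {t} → ¬ Balanced t → ∃ λ c → Adj (T D) t c × Heavy t c
  unbalanced⇒heavy {t} unbalanced
    with ¬∀⟶∃¬ (m D) (λ c → Adj (T D) t c → ¬ Heavy t c) (λ c → adj? t c →-dec ¬? (s ℕ.≤? _)) unbalanced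
  ... | c , ¬light with adj? t c
  ...   | yes t~c = c , t~c , decidable-stable (s ℕ.≤? _) (λ ¬heavy → ¬light λ _ → ¬heavy)
  ...   | no ¬t~c = ⊥-elim (¬light (⊥-elim ∘ ¬t~c))

  balanced? : ∀ t → Dec (Balanced t)
  balanced? t = all? λ c → adj? t c →-dec ¬? (s ℕ.≤? _)

  -- Step into a heavy branch. The next heavy branch cannot lead back, as both sides of an
  -- edge are never heavy, so it is a strictly smaller branch.
  balanced-within-heavy : ∀ {t c} → Adj (T D) t c → Heavy t c → ∃ Balanced
  balanced-within-heavy = <-rec P descend _ refl
    where
    P : ℕ → Set
    P N = ∀ {t c} → ∣ branch t c ∣ ≡ N → Adj (T D) t c → Heavy t c → ∃ Balanced
    descend : ∀ N → (∀ {N'} → N' < N → P N') → P N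
    descend _ smaller {t} {c} refl t~c heavy with balanced? c
    ... | yes balanced = c , balanced
    ... | no unbalanced with unbalanced⇒heavy unbalanced
    ...   | c' , c~c' , heavy' with c' ≟ t
    ...     | yes refl = ⊥-elim (<⇒≱ (heavy⇒complement-light t~c heavy)
                (≤-trans heavy' (p⊆q⇒∣p∣≤∣q∣ (⋃-monoˡ (bag D) (x∉p⇒x∈∁p ∘ branches-disjoint t~c)))))
    ...     | no c'≢t = smaller (p⊂q⇒∣p∣<∣q∣ (branch-⊂ t~c c~c' c'≢t)) refl c~c' heavy'

  ∃-balanced : ∃ Balanced
  ∃-balanced with balanced? (IsTree.nonempty (isTree D))
  ... | yes balanced = _ , balanced
  ... | no unbalanced with unbalanced⇒heavy unbalanced
  ...   | c , t~c , heavy = balanced-within-heavy t~c heavy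

  module _ {t} (balanced : Balanced t) where

    mass : Subset (m D) → Subset n
    mass F = ⋃[ F ] (⋃bag ∘ branch t)

    -- A subfamily of mass in [s, 2s) is separated by R from at least n − 2s ≥ s vertices.
    no-heavy-family : s + (s + s) ≤ n → ∀ {F R} → F ⊆ neighbours t → ∣ R ∣ < k →
      (∀ {c} → c ∈ F → adhesion D c t ⊆ R) → ¬ s ≤ ∣ mass F ∣
    no-heavy-family 3s≤n {F} {R} F⊆N ∣R∣<k F⊆R heavy
      with ⋃-subfamily-between s F (⋃bag ∘ branch t) 1≤s
             (λ c∈F → ≰⇒> (balanced _ (∈-neighbours⁻ (F⊆N c∈F)))) heavy
    ... | F' , F'⊆F , s≤∣mass∣ , ∣mass∣<2s =
      no-balanced-separation unbreakable X leaving ∣R∣<k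
        (subst (s ≤_) (≡.sym ∣⋃bagX∣) s≤∣mass∣)
        (<⇒≤ (m+n≤o+p∧o<n⇒m<p (≤-trans 3s≤n (n≤∣⋃bag∣+∣⋃bag-∁∣ X))
                                (subst (_< s + s) (≡.sym ∣⋃bagX∣) ∣mass∣<2s)))
      where
      X : Subset (m D)
      X = ⋃[ F' ] branch t
      ∣⋃bagX∣ : ∣ ⋃bag X ∣ ≡ ∣ mass F' ∣
      ∣⋃bagX∣ = cong ∣_∣ (⋃-assoc F' (branch t) (bag D))
      leaving : AdhesionsLeaving X ⊆ R
      leaving p∈X q∉X p~q with ∈-⋃⁻ F' (branch t) p∈X
      ... | c , c∈F' , p∈ = ⊆-trans
        (branch-leaving (∈-neighbours⁻ (F⊆N (F'⊆F c∈F'))) p∈ (q∉X ∘ ∈-⋃⁺ F' (branch t) c∈F') p~q)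
        (F⊆R (F'⊆F c∈F'))

    module _ (3s≤n : s + (s + s) ≤ n) (bag-small : ∣ bag D t ∣ < 2 * s) where

      within : Subset n → Subset (m D) → Subset (m D)
      within R F = F ∩ toSubset (λ c → adhesion D c t ⊆? R)

      through : Fin n → Subset (m D) → Subset (m D)
      through v F = F ∩ toSubset (λ c → v ∈? adhesion D c t)

      mass-split : ∀ F R → mass F ⊆ mass (within R F) ∪ ⋃[ bag D t ∩ ∁ R ] (λ v → mass (through v F))
      mass-split F R {w} w∈ with ∈-⋃⁻ F _ w∈
      ... | c , c∈F , w∈c with adhesion D c t ⊆? R
      ... | yes ⊆R = p⊆p∪q _ (∈-⋃⁺ (within R F) _ (x∈p∩q⁺ (c∈F , ∈-toSubset⁺ _ (λ {x} → ⊆R {x}))) w∈c)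
      ... | no  ⊈R with p⊈q⇒∃∈p∖q ⊈R
      ...   | v , v∈ , v∉R = q⊆p∪q _ _
        (∈-⋃⁺ (bag D t ∩ ∁ R) _ (x∈p∩q⁺ (proj₂ (x∈p∩q⁻ (bag D c) _ v∈) , x∉p⇒x∈∁p v∉R))
          (∈-⋃⁺ (through v F) _ (x∈p∩q⁺ (c∈F , ∈-toSubset⁺ _ v∈)) w∈c))

      -- Once |R| = k − 1 every adhesion in F equals R.
      -- Otherwise the branches with adhesion R have mass < s by no-heavy-family, and every
      -- other one has some v ∈ bag t − R in its adhesion; there are < 2s such v, and adding v
      -- to R bounds the mass through v by induction.
      ∣mass∣<[2s]^[1+d] : ∀ d {F R} → F ⊆ neighbours t → suc d + ∣ R ∣ ≡ k →
        (∀ {c} → c ∈ F → R ⊆ adhesion D c t) → ∣ mass F ∣ < (2 * s) ^ suc d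
      ∣mass∣<[2s]^[1+d] zero {F} {R} F⊆N ∣R∣+1≡k R⊆ =
        <-≤-trans (≰⇒> (no-heavy-family 3s≤n F⊆N (≤-reflexive ∣R∣+1≡k) ⊆R)) (s≤[2s]^[1+d] 0)
        where
        ⊆R : ∀ {c} → c ∈ F → adhesion D c t ⊆ R
        ⊆R c∈F = p⊆q∧∣q∣≤∣p∣⇒q⊆p (R⊆ c∈F)
          (≤-pred (≤-trans (adhesions<k _ t (Graph.sym (T D) (∈-neighbours⁻ (F⊆N c∈F)))) (≤-reflexive (≡.sym ∣R∣+1≡k))))
      ∣mass∣<[2s]^[1+d] (suc d) {F} {R} F⊆N eq R⊆ = begin-strict
        ∣ mass F ∣
          ≤⟨ p⊆q⇒∣p∣≤∣q∣ (mass-split F R) ⟩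
        ∣ mass (within R F) ∪ ⋃[ bag D t ∩ ∁ R ] _ ∣
          ≤⟨ ∣p∪q∣≤∣p∣+∣q∣ (mass (within R F)) _ ⟩
        ∣ mass (within R F) ∣ + ∣ ⋃[ bag D t ∩ ∁ R ] _ ∣
          ≤⟨ +-monoʳ-≤ _ (∣⋃∣≤∣Q∣*b (bag D t ∩ ∁ R) _ P (<⇒≤ ∘ through-light)) ⟩
        ∣ mass (within R F) ∣ + ∣ bag D t ∩ ∁ R ∣ * P
          <⟨ a<p∧b<q⇒a+b*p<q*p within-light (≤-<-trans (∣p∩q∣≤∣p∣ (bag D t) (∁ R)) bag-small) ⟩
        2 * s * P
          ∎
        where
        open ≤-Reasoning
        P : ℕ
        P = (2 * s) ^ suc d
        within-light : ∣ mass (within R F) ∣ < P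
        within-light = <-≤-trans
          (≰⇒> (no-heavy-family 3s≤n (F⊆N ∘ proj₁ ∘ x∈p∩q⁻ F _) (≤-trans (s≤s (m≤n+m _ (suc d))) (≤-reflexive eq))
            λ c∈ {x} → ∈-toSubset⁻ _ (proj₂ (x∈p∩q⁻ F _ c∈)) {x}))
          (s≤[2s]^[1+d] d)
        through-light : ∀ {v} → v ∈ bag D t ∩ ∁ R → ∣ mass (through v F) ∣ < P
        through-light {v} v∈ = ∣mass∣<[2s]^[1+d] d (F⊆N ∘ proj₁ ∘ x∈p∩q⁻ F _) ∣R∪v∣+d+1≡k R∪v⊆
          where
          v∉R : v ∉ R
          v∉R = x∈∁p⇒x∉p (proj₂ (x∈p∩q⁻ (bag D t) _ v∈))
          ∣R∪v∣+d+1≡k : suc d + ∣ R ∪ ⁅ v ⁆ ∣ ≡ k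
          ∣R∪v∣+d+1≡k = ≡.trans (cong (suc d +_) (∣p∪⁅x⁆∣≡1+∣p∣ R v∉R)) (≡.trans (+-suc (suc d) ∣ R ∣) eq)
          R∪v⊆ : ∀ {c} → c ∈ through v F → R ∪ ⁅ v ⁆ ⊆ adhesion D c t
          R∪v⊆ c∈ x∈ with x∈p∩q⁻ F _ c∈ | x∈p∪q⁻ R ⁅ v ⁆ x∈
          ... | c∈F , _   | inj₁ x∈R = R⊆ c∈F x∈R
          ... | _   , v∈A | inj₂ x∈v rewrite x∈⁅y⁆⇒x≡y v x∈v = ∈-toSubset⁻ _ v∈A

    balanced⇒large-bag : 1 ≤ k → (2 * s) ^ k + 2 * s ≤ n → 2 * s ≤ ∣ bag D t ∣
    balanced⇒large-bag 1≤k n-large = ≮⇒≥ λ bag-small → <-asym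
      (m+n≤o+p∧o<n⇒m<p (≤-trans n-large n≤∣bag∣+∣mass∣) bag-small)
      (subst (λ e → ∣ mass (neighbours t) ∣ < (2 * s) ^ e) (suc-pred k)
        (∣mass∣<[2s]^[1+d] 3s≤n bag-small (pred k) ⊆-refl ∣⊥∣+k≡k (λ _ → ⊥⊆)))
      where
      instance
        k≢0 : NonZero k
        k≢0 = ℕ.>-nonZero 1≤k
      s≤[2s]^k : s ≤ (2 * s) ^ k
      s≤[2s]^k = subst (λ e → s ≤ (2 * s) ^ e) (suc-pred k) (s≤[2s]^[1+d] (pred k))
      3s≤n : s + (s + s) ≤ n
      3s≤n = ≤-trans (+-mono-≤ s≤[2s]^k (+-monoʳ-≤ s (m≤m+n s 0))) n-large
      ∣⊥∣+k≡k : suc (pred k) + ∣ ⊥ {n} ∣ ≡ k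
      ∣⊥∣+k≡k = ≡.trans (cong (suc (pred k) +_) (∣⊥∣≡0 n)) (≡.trans (+-identityʳ _) (suc-pred k))
      ⊤⊆ : ⊤ ⊆ bag D t ∪ mass (neighbours t)
      ⊤⊆ {v} _ with vertexNonempty D v
      ... | x , v∈x with x ≟ t
      ... | yes refl = p⊆p∪q _ v∈x
      ... | no  x≢t with ∈-some-branch x≢t
      ...   | c , c∈N , x∈ = q⊆p∪q (bag D t) _ (∈-⋃⁺ (neighbours t) _ c∈N (∈-⋃⁺ (branch t c) (bag D) x∈ v∈x))
      n≤∣bag∣+∣mass∣ : n ≤ ∣ bag D t ∣ + ∣ mass (neighbours t) ∣
      n≤∣bag∣+∣mass∣ = begin
        n                                      ≡⟨ ∣⊤∣≡n n ⟨
        ∣ ⊤ {n} ∣                              ≤⟨ p⊆q⇒∣p∣≤∣q∣ ⊤⊆ ⟩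
        ∣ bag D t ∪ mass (neighbours t) ∣      ≤⟨ ∣p∪q∣≤∣p∣+∣q∣ (bag D t) _ ⟩
        ∣ bag D t ∣ + ∣ mass (neighbours t) ∣  ∎
        where open ≤-Reasoning

  large-bag-unique : ∀ {t t'} → 2 * s ≤ ∣ bag D t ∣ → 2 * s ≤ ∣ bag D t' ∣ → t' ≡ t
  large-bag-unique {t} {t'} large large' with t' ≟ t
  ... | yes t'≡t = t'≡t
  ... | no  t'≢t with ∈-some-branch t'≢t
  ...   | c , c∈N , t'∈ = ⊥-elim (no-balanced-separation unbreakable (branch t c)
            (branch-leaving t~c) (adhesions<k c t (Graph.sym (T D) t~c))
            (≤-trans s≤2s (≤-trans large' (p⊆q⇒∣p∣≤∣q∣ (∈-⋃⁺ (branch t c) (bag D) t'∈))))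
            (≤-trans s≤2s (≤-trans large
              (p⊆q⇒∣p∣≤∣q∣ (∈-⋃⁺ (∁ (branch t c)) (bag D) (x∉p⇒x∈∁p ∉-branch-root))))))
    where
    t~c : Adj (T D) t c
    t~c = ∈-neighbours⁻ c∈N
    s≤2s : s ≤ 2 * s
    s≤2s = m≤m+n s (s + 0)

¬¬-Π-Fin : ∀ {n} {P : Fin n → Set} → (∀ i → ¬ ¬ P i) → ¬ ¬ (∀ i → P i)
¬¬-Π-Fin {zero}  ¬¬P ¬∀P = ¬∀P λ ()
¬¬-Π-Fin {suc n} ¬¬P ¬∀P =
  ¬¬P zero λ P₀ → ¬¬-Π-Fin (¬¬P ∘ suc) λ P₊ → ¬∀P λ { zero → P₀ ; (suc i) → P₊ i }

-- Adjacency in T is an arbitrary type family, so it is decidable only under double negation.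
-- This suffices: the large bag itself is found by deciding bag sizes, and all other steps
-- prove contradictions.
¬¬-decidable-tree : ∀ {n} {G : Graph n} (D : TreeDecomposition G) →
  ¬ ¬ ((∀ x y → Dec (Adj (T D) x y)) × (∀ t c x → Dec (WalkIn (T D) (_≢ t) c x)))
¬¬-decidable-tree D ¬decidable =
  ¬¬-Π-Fin (λ x → ¬¬-Π-Fin λ y → ¬¬-excluded-middle) λ adj? →
  ¬¬-Π-Fin (λ t → ¬¬-Π-Fin λ c → ¬¬-Π-Fin λ x → ¬¬-excluded-middle) λ branch? →
  ¬decidable (adj? , branch?)

lemma15p2 : (s k : ℕ) → 1 ≤ k → k ≤ s → (n : ℕ) → (G : Graph n) →
    Unbreakable s k G → (2 * s) ^ (k + 2) ≤ n →
    (D : TreeDecomposition G) → AdhesionsBelow D k →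
    ExactlyOneBagOfSizeAtLeast D (2 * s)
lemma15p2 s k 1≤k k≤s n G unbreakable n-large D adhesions<k = t , large , unique
  where
  module Bags = Unbreakable-TreeDecomposition (≤-trans 1≤k k≤s) unbreakable D adhesions<k
  2≤2s : 2 ≤ 2 * s
  2≤2s = *-monoʳ-≤ 2 (≤-trans 1≤k k≤s)
  large-bag : ∃ λ t → 2 * s ≤ ∣ bag D t ∣
  large-bag = decidable-stable (any? λ t → 2 * s ℕ.≤? ∣ bag D t ∣) λ none →
    ¬¬-decidable-tree D λ (adj? , branch?) →
      let t , balanced = Bags.∃-balanced adj? branch?
      in  none (t , Bags.balanced⇒large-bag adj? branch? balanced 1≤k
                      (≤-trans (m^k+m≤m^[k+2] (2 * s) k 2≤2s) n-large))
  t : Fin (m D)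
  t = proj₁ large-bag
  large : 2 * s ≤ ∣ bag D t ∣
  large = proj₂ large-bag
  unique : ∀ t' → 2 * s ≤ ∣ bag D t' ∣ → t' ≡ t
  unique t' large' = decidable-stable (t' ≟ t) λ t'≢t →
    ¬¬-decidable-tree D λ (adj? , branch?) → t'≢t (Bags.large-bag-unique adj? branch? large large')
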